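{- Let $1\le r\le n/2$ and let $\mathcal{F}\subseteq\binom{[n]}{r}$ be shifted and intersecting. For $F\in\mathcal{F}$ let $\kappa_F$ be the largest nonnegative integer $\kappa$ with $2\kappa\le n$ and $|F\cap[2\kappa]|=\kappa$, and define $\phi(F)=F$ if $1\in F$ and $\phi(F)=F\,\triangle\,[2\kappa_F]$ if $1\notin F$. Then the map $\phi$ on $\mathcal{F}$ is injective.
   Context: $[m]=\{1,\dots,m\}$ (with $[0]=\emptyset$), $\binom{X}{r}$ is the family of $r$-element subsets of $X$, and $\triangle$ is symmetric difference. A family $\mathcal{F}$ is intersecting if $A\cap B\neq\emptyset$ for all $A,B\in\mathcal{F}$. For $i,j\in[n]$ and $A\subseteq[n]$, $\sigma_{i,j}(A)=(A\setminus\{i\})\cup\{j\}$ if $i\in A$, $j\notin A$, and $\sigma_{i,j}(A)=A$ otherwise; for a family $\mathcal{F}$, $\sigma_{i,j}(\mathcal{F})=\{\sigma'_{i,j}(A):A\in\mathcal{F}\}$ where $\sigma'_{i,j}(A)=\sigma_{i,j}(A)$ if $\sigma_{i,j}(A)\notin\mathcal{F}$ and $\sigma'_{i,j}(A)=A$ otherwise. $\mathcal{F}\subseteq\binom{[n]}{r}$ is shifted if $\sigma_{i,j}(\mathcal{F})=\mathcal{F}$ for all $1\le j<i\le n$. -}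

module Defs where

open import Data.Nat using (ℕ; zero; suc; _+_; _*_; _<ᵇ_; _≤_; _<_; _≤?_; _≟_)
open import Data.Fin using (Fin; toℕ)
open import Data.Fin.Subset using (Subset; _∈_; _∉_; _∩_; _∪_; _─_; _-_; ⁅_⁆; ∣_∣; Nonempty)
open import Data.Fin.Subset.Properties using (_∈?_)
open import Data.Vec using (tabulate; _∷_)
open import Data.Product using (Σ; _×_; ∃)
open import Data.Bool using (Bool; true; false)
open import Relation.Nullary using (¬_; Dec; yes; no)
open import Relation.Binary.PropositionalEquality using (_≡_)

-- Subsets of [n] = {1,…,n} are represented as Subset n; the element
-- (i : Fin n) stands for the integer toℕ i + 1.

Family : ℕ → Set₁
Family n = Subset n → Set

-- [m] ∩ [n] as a subset of [n]: elements with toℕ i < m (i.e. integer i+1 ≤ m).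
prefix : ∀ {n} → ℕ → Subset n
prefix m = tabulate (λ i → toℕ i <ᵇ m)

_△_ : ∀ {n} → Subset n → Subset n → Subset n
A △ B = (A ─ B) ∪ (B ─ A)

oneIn : ∀ {n} → Subset n → Bool
oneIn {zero} _ = false
oneIn {suc n} (b ∷ _) = b

σ : ∀ {n} → Fin n → Fin n → Subset n → Subset n
σ i j A with i ∈? A | j ∈? A
... | yes _ | no _ = (A - i) ∪ ⁅ j ⁆
... | _     | _    = A

-- membership in σ_{i,j}(𝓕) = { σ'_{i,j}(A) : A ∈ 𝓕 }
InShift : ∀ {n} → Fin n → Fin n → Family n → Family n
InShift i j 𝓕 B =
  Σ (Subset _) (λ A → 𝓕 A ×
    (((¬ 𝓕 (σ i j A)) × (B ≡ σ i j A)) ⊎′ ((𝓕 (σ i j A)) × (B ≡ A))))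
  where
  open import Data.Sum using () renaming (_⊎_ to _⊎′_)

Shifted : ∀ {n} → Family n → Set
Shifted {n} 𝓕 = (i j : Fin n) → toℕ j < toℕ i →
  (B : Subset n) → (InShift i j 𝓕 B → 𝓕 B) × (𝓕 B → InShift i j 𝓕 B)

Uniform : ∀ {n} → ℕ → Family n → Set
Uniform r 𝓕 = ∀ A → 𝓕 A → ∣ A ∣ ≡ r

Intersecting : ∀ {n} → Family n → Set
Intersecting 𝓕 = ∀ A B → 𝓕 A → 𝓕 B → Nonempty (A ∩ B)

kappaUpTo : ∀ {n} → Subset n → ℕ → ℕ
kappaUpTo F zero = zero
kappaUpTo {n} F (suc m) with 2 * suc m ≤? n | ∣ F ∩ prefix (2 * suc m) ∣ ≟ suc m
... | yes _ | yes _ = suc m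
... | _     | _     = kappaUpTo F m

-- κ_F : the largest κ with 2κ ≤ n and |F ∩ [2κ]| = κ  (any such κ is ≤ n)
kappa : ∀ {n} → Subset n → ℕ
kappa {n} F = kappaUpTo F n

φ : ∀ {n} → Subset n → Subset n
φ F with oneIn F
... | true  = F
... | false = F △ prefix (2 * kappa F)

-- If 1 ∈ A and 1 ∉ B then A = B △ [2κ_B], so the mixed case is excluded once
-- G △ [2κ_G] ∉ 𝓕 for every G ∈ 𝓕. Maximality of κ_G, together with a discrete
-- intermediate value argument (2|G| ≤ n), gives |G ∩ [y]| ≤ y/2 for all y ≥ 2κ_G.
-- Hence the set G′ that agrees with G on [2κ_G] and then takes the first
-- |G ∖ [2κ_G]| points outside G arises from G by left shifts, so G′ ∈ 𝓕 by
-- shiftedness; but G′ is disjoint from G △ [2κ_G], against 𝓕 being intersecting.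
-- If 1 ∉ A, B and A △ [2κ_A] = B △ [2κ_B] with κ_A < κ_B, counting shows
-- |A ∩ [2κ_B]| = κ_B, contradicting maximality of κ_A; so κ_A = κ_B and A = B.
module Submission where

open import Defs
open import Data.Nat using (ℕ; zero; suc; _+_; _*_; _∸_; _≤_; _<_; z≤n; s≤s; _≤?_; _≟_)
open import Data.Nat.Properties
open import Data.Fin using (Fin; zero; suc; toℕ)
open import Data.Fin.Subset using (Subset; _∈_; _∉_; _∩_; _∪_; _─_; ⁅_⁆; ∣_∣; Nonempty; ⊥)
open import Data.Fin.Subset.Properties
  using (_∈?_; ∉⊥; p∩q⊆p; p⊆q⇒∣p∣≤∣q∣; p─⊥≡p; ∪-identityʳ)
open import Data.Vec using ([]; _∷_; here; there; _[_]≔_)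
open import Data.Bool using (true; false)
open import Data.Product using (_×_; _,_; proj₁; ∃-syntax)
open import Data.Sum using (inj₁; inj₂)
open import Data.Empty as Empty using (⊥-elim)
open import Function using (_∘_)
open import Relation.Nullary using (¬_; yes; no; contradiction)
open import Relation.Binary.PropositionalEquality

private variable
  n : ℕ

X△Y△Y≡X : (X Y : Subset n) → (X △ Y) △ Y ≡ X
X△Y△Y≡X []         []         = refl
X△Y△Y≡X (true ∷ X)  (true ∷ Y)  = cong (true ∷_) (X△Y△Y≡X X Y)
X△Y△Y≡X (true ∷ X)  (false ∷ Y) = cong (true ∷_) (X△Y△Y≡X X Y)
X△Y△Y≡X (false ∷ X) (true ∷ Y)  = cong (false ∷_) (X△Y△Y≡X X Y)
X△Y△Y≡X (false ∷ X) (false ∷ Y) = cong (false ∷_) (X△Y△Y≡X X Y)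

X△[0]≡X : (X : Subset n) → X △ prefix 0 ≡ X
X△[0]≡X []          = refl
X△[0]≡X (true ∷ X)  = cong (true ∷_) (X△[0]≡X X)
X△[0]≡X (false ∷ X) = cong (false ∷_) (X△[0]≡X X)

∣X∩[0]∣≡0 : (X : Subset n) → ∣ X ∩ prefix 0 ∣ ≡ 0
∣X∩[0]∣≡0 []          = refl
∣X∩[0]∣≡0 (true ∷ X)  = ∣X∩[0]∣≡0 X
∣X∩[0]∣≡0 (false ∷ X) = ∣X∩[0]∣≡0 X

∣X∩[k]∣≤∣X∩[1+k]∣ : ∀ k (X : Subset n) → ∣ X ∩ prefix k ∣ ≤ ∣ X ∩ prefix (suc k) ∣
∣X∩[k]∣≤∣X∩[1+k]∣ zero    X           = subst (_≤ ∣ X ∩ prefix 1 ∣) (sym (∣X∩[0]∣≡0 X)) z≤n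
∣X∩[k]∣≤∣X∩[1+k]∣ (suc k) []          = z≤n
∣X∩[k]∣≤∣X∩[1+k]∣ (suc k) (true ∷ X)  = s≤s (∣X∩[k]∣≤∣X∩[1+k]∣ k X)
∣X∩[k]∣≤∣X∩[1+k]∣ (suc k) (false ∷ X) = ∣X∩[k]∣≤∣X∩[1+k]∣ k X

∣X∩[k]∣≡∣X∣ : ∀ k (X : Subset n) → n ≤ k → ∣ X ∩ prefix k ∣ ≡ ∣ X ∣
∣X∩[k]∣≡∣X∣ k       []          _         = refl
∣X∩[k]∣≡∣X∣ (suc k) (true ∷ X)  (s≤s n≤k) = cong suc (∣X∩[k]∣≡∣X∣ k X n≤k)
∣X∩[k]∣≡∣X∣ (suc k) (false ∷ X) (s≤s n≤k) = ∣X∩[k]∣≡∣X∣ k X n≤k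

suffix : (j : ℕ) → Subset n → Subset (n ∸ j)
suffix zero    X       = X
suffix (suc j) []      = []
suffix (suc j) (_ ∷ X) = suffix j X

∣X∩[j+k]∣ : ∀ j k (X : Subset n) →
  ∣ X ∩ prefix (j + k) ∣ ≡ ∣ X ∩ prefix j ∣ + ∣ suffix j X ∩ prefix k ∣
∣X∩[j+k]∣ zero    k X           = cong (_+ ∣ X ∩ prefix k ∣) (sym (∣X∩[0]∣≡0 X))
∣X∩[j+k]∣ (suc j) k []          = refl
∣X∩[j+k]∣ (suc j) k (true ∷ X)  = cong suc (∣X∩[j+k]∣ j k X)
∣X∩[j+k]∣ (suc j) k (false ∷ X) = ∣X∩[j+k]∣ j k X

-- Stated without subtraction: (X △ [j]) ∩ [k] = ([j] ∖ X) ∪ (X ∩ [k] ∖ [j]).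
∣X△[j]∩[k]∣ : ∀ j k (X : Subset n) → j ≤ k → j ≤ n →
  ∣ (X △ prefix j) ∩ prefix k ∣ + 2 * ∣ X ∩ prefix j ∣ ≡ j + ∣ X ∩ prefix k ∣
∣X△[j]∩[k]∣ zero    k       X           _         _
  rewrite X△[0]≡X X | ∣X∩[0]∣≡0 X = +-identityʳ _
∣X△[j]∩[k]∣ (suc j) k       []          _         ()
∣X△[j]∩[k]∣ (suc j) zero    (_ ∷ X)     ()        _
∣X△[j]∩[k]∣ (suc j) (suc k) (false ∷ X) (s≤s j≤k) (s≤s j≤n) =
  cong suc (∣X△[j]∩[k]∣ j k X j≤k j≤n)
∣X△[j]∩[k]∣ (suc j) (suc k) (true ∷ X)  (s≤s j≤k) (s≤s j≤n) = begin
  c + 2 * suc d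
    ≡⟨ cong (c +_) (*-suc 2 d) ⟩
  c + suc (suc (2 * d))
    ≡⟨ trans (+-suc c _) (cong suc (+-suc c _)) ⟩
  suc (suc (c + 2 * d))
    ≡⟨ cong (λ m → suc (suc m)) (∣X△[j]∩[k]∣ j k X j≤k j≤n) ⟩
  suc (suc (j + e))
    ≡⟨ cong suc (sym (+-suc j e)) ⟩
  suc j + suc e ∎
  where
  open ≡-Reasoning
  c = ∣ (X △ prefix j) ∩ prefix k ∣
  d = ∣ X ∩ prefix j ∣
  e = ∣ X ∩ prefix k ∣

balanced-flip : ∀ (X : Subset n) {a} → 2 * a ≤ n → ∣ X ∩ prefix (2 * a) ∣ ≡ a →
  ∣ (X △ prefix (2 * a)) ∩ prefix (2 * a) ∣ ≡ a
balanced-flip X {a} 2a≤n bal = +-cancelʳ-≡ (2 * a) _ _ (begin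
  ∣ (X △ [2a]) ∩ [2a] ∣ + 2 * a
    ≡⟨ cong (λ c → ∣ (X △ [2a]) ∩ [2a] ∣ + 2 * c) (sym bal) ⟩
  ∣ (X △ [2a]) ∩ [2a] ∣ + 2 * ∣ X ∩ [2a] ∣
    ≡⟨ ∣X△[j]∩[k]∣ (2 * a) (2 * a) X ≤-refl 2a≤n ⟩
  2 * a + ∣ X ∩ [2a] ∣
    ≡⟨ cong (2 * a +_) bal ⟩
  2 * a + a
    ≡⟨ +-comm (2 * a) a ⟩
  a + 2 * a ∎)
  where
  open ≡-Reasoning
  [2a] = prefix (2 * a)

flip-balance-transfer : ∀ (A B : Subset n) {a b} → a ≤ b → 2 * b ≤ n →
  ∣ A ∩ prefix (2 * a) ∣ ≡ a → ∣ B ∩ prefix (2 * b) ∣ ≡ b →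
  A △ prefix (2 * a) ≡ B △ prefix (2 * b) → ∣ A ∩ prefix (2 * b) ∣ ≡ b
flip-balance-transfer {n} A B {a} {b} a≤b 2b≤n balA balB eq = +-cancelʳ-≡ (2 * a) _ _ (begin
  ∣ A ∩ [2b] ∣ + 2 * a
    ≡⟨ cong₂ (λ Z c → ∣ Z ∩ [2b] ∣ + 2 * c) (sym Y△[2a]≡A) (sym Y-a) ⟩
  ∣ (Y △ [2a]) ∩ [2b] ∣ + 2 * ∣ Y ∩ [2a] ∣
    ≡⟨ ∣X△[j]∩[k]∣ (2 * a) (2 * b) Y 2a≤2b 2a≤n ⟩
  2 * a + ∣ Y ∩ [2b] ∣
    ≡⟨ cong (2 * a +_) (balanced-flip B 2b≤n balB) ⟩
  2 * a + b
    ≡⟨ +-comm (2 * a) b ⟩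
  b + 2 * a ∎)
  where
  open ≡-Reasoning
  [2a] = prefix (2 * a)
  [2b] = prefix (2 * b)
  Y = B △ [2b]
  2a≤2b : 2 * a ≤ 2 * b
  2a≤2b = *-monoʳ-≤ 2 a≤b
  2a≤n : 2 * a ≤ n
  2a≤n = ≤-trans 2a≤2b 2b≤n
  Y-a : ∣ Y ∩ [2a] ∣ ≡ a
  Y-a = subst (λ Z → ∣ Z ∩ [2a] ∣ ≡ a) eq (balanced-flip A 2a≤n balA)
  Y△[2a]≡A : Y △ [2a] ≡ A
  Y△[2a]≡A = trans (cong (_△ [2a]) (sym eq)) (X△Y△Y≡X A [2a])

kappaUpTo-balanced : ∀ (F : Subset n) M → ∣ F ∩ prefix (2 * kappaUpTo F M) ∣ ≡ kappaUpTo F M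
kappaUpTo-balanced F zero = ∣X∩[0]∣≡0 F
kappaUpTo-balanced {n} F (suc M) with 2 * suc M ≤? n | ∣ F ∩ prefix (2 * suc M) ∣ ≟ suc M
... | yes _ | yes bal = bal
... | yes _ | no _    = kappaUpTo-balanced F M
... | no _  | _       = kappaUpTo-balanced F M

kappaUpTo-fits : ∀ (F : Subset n) M → 2 * kappaUpTo F M ≤ n
kappaUpTo-fits F zero = z≤n
kappaUpTo-fits {n} F (suc M) with 2 * suc M ≤? n | ∣ F ∩ prefix (2 * suc M) ∣ ≟ suc M
... | yes fits | yes _ = fits
... | yes _    | no _  = kappaUpTo-fits F M
... | no _     | _     = kappaUpTo-fits F M

kappaUpTo-maximal : ∀ (F : Subset n) M {m} → m ≤ M → 2 * m ≤ n →
  ∣ F ∩ prefix (2 * m) ∣ ≡ m → m ≤ kappaUpTo F M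
kappaUpTo-maximal F zero m≤0 _ _ = m≤0
kappaUpTo-maximal {n} F (suc M) m≤M 2m≤n bal
  with 2 * suc M ≤? n | ∣ F ∩ prefix (2 * suc M) ∣ ≟ suc M
... | yes _ | yes _ = m≤M
... | yes _ | no unbal =
  kappaUpTo-maximal F M (≤-pred (≤∧≢⇒< m≤M λ { refl → unbal bal })) 2m≤n bal
... | no too-big | _ =
  kappaUpTo-maximal F M (≤-pred (≤∧≢⇒< m≤M λ { refl → too-big 2m≤n })) 2m≤n bal

kappa-maximal : ∀ (F : Subset n) {m} → 2 * m ≤ n → ∣ F ∩ prefix (2 * m) ∣ ≡ m → m ≤ kappa F
kappa-maximal {n} F {m} 2m≤n = kappaUpTo-maximal F n (≤-trans (m≤m+n m (m + 0)) 2m≤n) 2m≤n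

kappa-flip-≤ : ∀ (A B : Subset n) →
  A △ prefix (2 * kappa A) ≡ B △ prefix (2 * kappa B) → kappa B ≤ kappa A
kappa-flip-≤ {n} A B eq with ≤-total (kappa A) (kappa B)
... | inj₂ κB≤κA = κB≤κA
... | inj₁ κA≤κB = kappa-maximal A (kappaUpTo-fits B n)
  (flip-balance-transfer A B κA≤κB (kappaUpTo-fits B n)
    (kappaUpTo-balanced A n) (kappaUpTo-balanced B n) eq)

kappa-flip-injective : ∀ (A B : Subset n) →
  A △ prefix (2 * kappa A) ≡ B △ prefix (2 * kappa B) → A ≡ B
kappa-flip-injective A B eq = begin
  A                                            ≡⟨ sym (X△Y△Y≡X A _) ⟩
  (A △ prefix (2 * kappa A)) △ prefix (2 * kappa A) ≡⟨ cong₂ (λ Z k → Z △ prefix (2 * k)) eq κA≡κB ⟩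
  (B △ prefix (2 * kappa B)) △ prefix (2 * kappa B) ≡⟨ X△Y△Y≡X B _ ⟩
  B                                            ∎
  where
  open ≡-Reasoning
  κA≡κB : kappa A ≡ kappa B
  κA≡κB = ≤-antisym (kappa-flip-≤ B A (sym eq)) (kappa-flip-≤ A B eq)

monotone-fixedPoint : (f : ℕ → ℕ) → (∀ x → f x ≤ f (suc x)) →
  ∀ d y → y < f y → f (d + y) ≤ d + y → ∃[ z ] y < z × f z ≡ z
monotone-fixedPoint f mono zero y y<fy fy≤y = contradiction fy≤y (<⇒≱ y<fy)
monotone-fixedPoint f mono (suc d) y y<fy fN≤N with f (suc y) ≟ suc y
... | yes fixed = suc y , ≤-refl , fixed
... | no unfixed =
  let z , 1+y<z , fixed = monotone-fixedPoint f mono d (suc y)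
        (≤∧≢⇒< (≤-trans y<fy (mono y)) (unfixed ∘ sym))
        (subst (λ N → f N ≤ N) (sym (+-suc d y)) fN≤N)
  in z , <-trans (n<1+n y) 1+y<z , fixed

balanced-beyond-dense : ∀ (G : Subset n) {y} → 2 * ∣ G ∣ ≤ n → y < 2 * ∣ G ∩ prefix y ∣ →
  ∃[ m ] y < 2 * m × 2 * m ≤ n × ∣ G ∩ prefix (2 * m) ∣ ≡ m
balanced-beyond-dense {n} G {y} small dense
  with monotone-fixedPoint (λ x → 2 * ∣ G ∩ prefix x ∣)
         (λ x → *-monoʳ-≤ 2 (∣X∩[k]∣≤∣X∩[1+k]∣ x G)) n y dense full
  where
  full : 2 * ∣ G ∩ prefix (n + y) ∣ ≤ n + y
  full = subst (λ c → 2 * c ≤ n + y) (sym (∣X∩[k]∣≡∣X∣ (n + y) G (m≤m+n n y)))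
           (≤-trans small (m≤m+n n y))
... | z , y<z , fixed =
  ∣ G ∩ prefix z ∣ ,
  subst (y <_) (sym fixed) y<z ,
  ≤-trans (*-monoʳ-≤ 2 (p⊆q⇒∣p∣≤∣q∣ (p∩q⊆p G _))) small ,
  cong (λ k → ∣ G ∩ prefix k ∣) fixed

sparse-beyond-kappa : ∀ (G : Subset n) {y} → 2 * ∣ G ∣ ≤ n → 2 * kappa G ≤ y →
  2 * ∣ G ∩ prefix y ∣ ≤ y
sparse-beyond-kappa G {y} small 2κ≤y with 2 * ∣ G ∩ prefix y ∣ ≤? y
... | yes sparse = sparse
... | no dense with balanced-beyond-dense G small (≰⇒> dense)
...   | m , y<2m , 2m≤n , bal = contradiction (kappa-maximal G 2m≤n bal)
          (<⇒≱ (*-cancelˡ-< 2 _ _ (≤-<-trans 2κ≤y y<2m)))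

-- ShiftsTo d A B, read from left to right: B has so far d more elements than A,
-- and never fewer.  ShiftsTo 0 A B says that B arises from A by left shifts.
ShiftsTo : ℕ → Subset n → Subset n → Set
ShiftsTo d       []          []          = d ≡ 0
ShiftsTo d       (true ∷ A)  (true ∷ B)  = ShiftsTo d A B
ShiftsTo d       (false ∷ A) (false ∷ B) = ShiftsTo d A B
ShiftsTo d       (false ∷ A) (true ∷ B)  = ShiftsTo (suc d) A B
ShiftsTo zero    (true ∷ A)  (false ∷ B) = Empty.⊥
ShiftsTo (suc d) (true ∷ A)  (false ∷ B) = ShiftsTo d A B

LeftShiftClosed : (Subset n → Set) → Set
LeftShiftClosed {n} P = ∀ A (i j : Fin n) → toℕ j < toℕ i → i ∈ A → j ∉ A →
  P A → P (A [ i ]≔ false [ j ]≔ true)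

LeftShiftClosed-∷ : ∀ {P : Subset (suc n) → Set} b →
  LeftShiftClosed P → LeftShiftClosed (λ X → P (b ∷ X))
LeftShiftClosed-∷ b closed X i j j<i i∈X j∉X =
  closed (b ∷ X) (suc i) (suc j) (s≤s j<i) (there i∈X) (λ { (there j∈X) → j∉X j∈X })

ShiftsTo-absorb : ∀ d (A B : Subset n) → ShiftsTo (suc d) A B →
  ∃[ k ] k ∈ A × ShiftsTo d (A [ k ]≔ false) B
ShiftsTo-absorb d []          []          ()
ShiftsTo-absorb d (true ∷ A)  (true ∷ B)  s = zero , here , s
ShiftsTo-absorb d (true ∷ A)  (false ∷ B) s = zero , here , s
ShiftsTo-absorb d (false ∷ A) (false ∷ B) s =
  let k , k∈A , s′ = ShiftsTo-absorb d A B s in suc k , there k∈A , s′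
ShiftsTo-absorb d (false ∷ A) (true ∷ B)  s =
  let k , k∈A , s′ = ShiftsTo-absorb (suc d) A B s in suc k , there k∈A , s′

-- A new element of B in front is paid for by moving the next unmatched element of A there.
ShiftsTo-transport : ∀ (P : Subset n → Set) → LeftShiftClosed P →
  ∀ A B → ShiftsTo 0 A B → P A → P B
ShiftsTo-transport P closed []          []          _ pA = pA
ShiftsTo-transport P closed (true ∷ A)  (true ∷ B)  s pA =
  ShiftsTo-transport _ (LeftShiftClosed-∷ true closed) A B s pA
ShiftsTo-transport P closed (false ∷ A) (false ∷ B) s pA =
  ShiftsTo-transport _ (LeftShiftClosed-∷ false closed) A B s pA
ShiftsTo-transport P closed (false ∷ A) (true ∷ B)  s pA =
  let k , k∈A , s′ = ShiftsTo-absorb 0 A B s in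
  ShiftsTo-transport _ (LeftShiftClosed-∷ true closed) (A [ k ]≔ false) B s′
    (closed (false ∷ A) (suc k) zero (s≤s z≤n) (there k∈A) (λ ()) pA)

X─⁅i⁆ : (X : Subset n) (i : Fin n) → X ─ ⁅ i ⁆ ≡ X [ i ]≔ false
X─⁅i⁆ (x ∷ X) zero    = cong (false ∷_) (p─⊥≡p X)
X─⁅i⁆ (x ∷ X) (suc i) = cong (x ∷_) (X─⁅i⁆ X i)

X─⁅i⁆∪⁅j⁆ : (X : Subset n) (i j : Fin n) → toℕ j < toℕ i →
  (X ─ ⁅ i ⁆) ∪ ⁅ j ⁆ ≡ X [ i ]≔ false [ j ]≔ true
X─⁅i⁆∪⁅j⁆ (true ∷ X)  (suc i) zero    _         =
  cong (true ∷_) (trans (∪-identityʳ _) (X─⁅i⁆ X i))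
X─⁅i⁆∪⁅j⁆ (false ∷ X) (suc i) zero    _         =
  cong (true ∷_) (trans (∪-identityʳ _) (X─⁅i⁆ X i))
X─⁅i⁆∪⁅j⁆ (true ∷ X)  (suc i) (suc j) (s≤s j<i) = cong (true ∷_) (X─⁅i⁆∪⁅j⁆ X i j j<i)
X─⁅i⁆∪⁅j⁆ (false ∷ X) (suc i) (suc j) (s≤s j<i) = cong (false ∷_) (X─⁅i⁆∪⁅j⁆ X i j j<i)

σ-shift : ∀ (A : Subset n) (i j : Fin n) → toℕ j < toℕ i → i ∈ A → j ∉ A →
  σ i j A ≡ A [ i ]≔ false [ j ]≔ true
σ-shift A i j j<i i∈A j∉A with i ∈? A | j ∈? A
... | yes _ | no _    = X─⁅i⁆∪⁅j⁆ A i j j<i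
... | yes _ | yes j∈A = ⊥-elim (j∉A j∈A)
... | no i∉A | _      = ⊥-elim (i∉A i∈A)

-- 𝓕 need not be decidable, so σ_{i,j}(𝓕) = 𝓕 only excludes σ_{i,j}(A) ∉ 𝓕.
shifted⇒¬¬closed : ∀ {𝓕 : Family n} → Shifted 𝓕 → LeftShiftClosed (λ X → ¬ ¬ 𝓕 X)
shifted⇒¬¬closed {𝓕 = 𝓕} sh A i j j<i i∈A j∉A ¬¬A∈ σA∉ =
  ¬¬A∈ λ A∈ → σA∉ (proj₁ (sh i j j<i _) (A , A∈ , inj₁ (σA∉ ∘ subst 𝓕 σA≡ , sym σA≡)))
  where
  σA≡ : σ i j A ≡ A [ i ]≔ false [ j ]≔ true
  σA≡ = σ-shift A i j j<i i∈A j∉A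

firstGaps : ℕ → Subset n → Subset n
firstGaps k       []          = []
firstGaps k       (true ∷ X)  = false ∷ firstGaps k X
firstGaps zero    (false ∷ X) = false ∷ firstGaps zero X
firstGaps (suc k) (false ∷ X) = true ∷ firstGaps k X

firstGaps-disjoint : ∀ k (X : Subset n) → firstGaps k X ∩ X ≡ ⊥
firstGaps-disjoint k       []          = refl
firstGaps-disjoint k       (true ∷ X)  = cong (false ∷_) (firstGaps-disjoint k X)
firstGaps-disjoint zero    (false ∷ X) = cong (false ∷_) (firstGaps-disjoint zero X)
firstGaps-disjoint (suc k) (false ∷ X) = cong (false ∷_) (firstGaps-disjoint k X)

noGaps-shifts : ∀ (X : Subset n) e → ∣ X ∣ ≡ e → ShiftsTo e X (firstGaps 0 X)
noGaps-shifts []          e       ∣X∣≡e = sym ∣X∣≡e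
noGaps-shifts (true ∷ X)  zero    ()
noGaps-shifts (true ∷ X)  (suc e) ∣X∣≡e = noGaps-shifts X e (suc-injective ∣X∣≡e)
noGaps-shifts (false ∷ X) e       ∣X∣≡e = noGaps-shifts X e ∣X∣≡e

firstGaps-shifts : ∀ (X : Subset n) e k → (∀ x → 2 * ∣ X ∩ prefix x ∣ ≤ e + x) →
  k + e ≡ ∣ X ∣ → ShiftsTo e X (firstGaps k X)
firstGaps-shifts []          e       k       _      k+e≡0 = m+n≡0⇒n≡0 k k+e≡0
firstGaps-shifts (true ∷ X)  zero    k       sparse _     =
  contradiction (subst (_≤ 1) (*-suc 2 _) (sparse 1)) λ { (s≤s ()) }
firstGaps-shifts (true ∷ X)  (suc e) k       sparse k+e≡ =
  firstGaps-shifts X e k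
    (λ x → ≤-pred (≤-pred (subst₂ _≤_ (*-suc 2 _) (cong suc (+-suc e x)) (sparse (suc x)))))
    (suc-injective (trans (sym (+-suc k e)) k+e≡))
firstGaps-shifts (false ∷ X) e       zero    _      e≡    = noGaps-shifts X e (sym e≡)
firstGaps-shifts (false ∷ X) e       (suc k) sparse k+e≡ =
  firstGaps-shifts X (suc e) k
    (λ x → subst (2 * ∣ X ∩ prefix x ∣ ≤_) (+-suc e x) (sparse (suc x)))
    (trans (+-suc k e) k+e≡)

gapsAfter : ℕ → ℕ → Subset n → Subset n
gapsAfter zero    k X       = firstGaps k X
gapsAfter (suc j) k []      = []
gapsAfter (suc j) k (b ∷ X) = b ∷ gapsAfter j k X

gapsAfter-shifts : ∀ j k (X : Subset n) →
  ShiftsTo 0 (suffix j X) (firstGaps k (suffix j X)) → ShiftsTo 0 X (gapsAfter j k X)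
gapsAfter-shifts zero    k X           s = s
gapsAfter-shifts (suc j) k []          s = refl
gapsAfter-shifts (suc j) k (true ∷ X)  s = gapsAfter-shifts j k X s
gapsAfter-shifts (suc j) k (false ∷ X) s = gapsAfter-shifts j k X s

gapsAfter-disjoint : ∀ j k (X : Subset n) → gapsAfter j k X ∩ (X △ prefix j) ≡ ⊥
gapsAfter-disjoint zero    k X rewrite X△[0]≡X X = firstGaps-disjoint k X
gapsAfter-disjoint (suc j) k []          = refl
gapsAfter-disjoint (suc j) k (true ∷ X)  = cong (false ∷_) (gapsAfter-disjoint j k X)
gapsAfter-disjoint (suc j) k (false ∷ X) = cong (false ∷_) (gapsAfter-disjoint j k X)

kappa-flip-∉ : ∀ {𝓕 : Family n} → Shifted 𝓕 → Intersecting 𝓕 →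
  ∀ G → 2 * ∣ G ∣ ≤ n → 𝓕 G → ¬ 𝓕 (G △ prefix (2 * kappa G))
kappa-flip-∉ {n} {𝓕} sh int G small G∈ F∈ = ¬¬G′∈ λ G′∈ → disjoint (int G′ F G′∈ F∈)
  where
  j = 2 * kappa G
  F = G △ prefix j
  t = suffix j G
  G′ = gapsAfter j ∣ t ∣ G

  t-sparse : ∀ x → 2 * ∣ t ∩ prefix x ∣ ≤ x
  t-sparse x = +-cancelˡ-≤ j _ _ (begin
    j + 2 * ∣ t ∩ prefix x ∣
      ≡⟨ cong (λ c → 2 * c + 2 * ∣ t ∩ prefix x ∣) (sym (kappaUpTo-balanced G n)) ⟩
    2 * ∣ G ∩ prefix j ∣ + 2 * ∣ t ∩ prefix x ∣
      ≡⟨ sym (*-distribˡ-+ 2 ∣ G ∩ prefix j ∣ ∣ t ∩ prefix x ∣) ⟩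
    2 * (∣ G ∩ prefix j ∣ + ∣ t ∩ prefix x ∣)
      ≡⟨ cong (2 *_) (sym (∣X∩[j+k]∣ j x G)) ⟩
    2 * ∣ G ∩ prefix (j + x) ∣
      ≤⟨ sparse-beyond-kappa G small (m≤m+n j x) ⟩
    j + x ∎)
    where open ≤-Reasoning

  ¬¬G′∈ : ¬ ¬ 𝓕 G′
  ¬¬G′∈ = ShiftsTo-transport (λ X → ¬ ¬ 𝓕 X) (shifted⇒¬¬closed sh) G G′
    (gapsAfter-shifts j ∣ t ∣ G (firstGaps-shifts t 0 ∣ t ∣ t-sparse (+-identityʳ ∣ t ∣)))
    (λ G∉ → G∉ G∈)

  disjoint : ¬ Nonempty (G′ ∩ F)
  disjoint (x , x∈) = ∉⊥ (subst (x ∈_) (gapsAfter-disjoint j ∣ t ∣ G) x∈)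

claim5 : (n r : ℕ) → 1 ≤ r → 2 * r ≤ n → (𝓕 : Family n) →
    Uniform r 𝓕 → Shifted 𝓕 → Intersecting 𝓕 →
    (A B : Subset n) → 𝓕 A → 𝓕 B → φ A ≡ φ B → A ≡ B
claim5 n r _ 2r≤n 𝓕 uni sh int A B A∈ B∈ = φ-injective
  where
  small : ∀ {G} → 𝓕 G → 2 * ∣ G ∣ ≤ n
  small {G} G∈ = subst (λ s → 2 * s ≤ n) (sym (uni G G∈)) 2r≤n

  φ-injective : φ A ≡ φ B → A ≡ B
  φ-injective eq with oneIn A | oneIn B
  ... | true  | true  = eq
  ... | true  | false = ⊥-elim (kappa-flip-∉ sh int B (small B∈) B∈ (subst 𝓕 eq A∈))
  ... | false | true  = ⊥-elim (kappa-flip-∉ sh int A (small A∈) A∈ (subst 𝓕 (sym eq) B∈))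
  ... | false | false = kappa-flip-injective A B eq
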